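{- Let $d\ge1$. For $h\ge0$, let $n_h$ be the maximum number of vertices of height $h$ in an FDAG all of whose vertices have outdegree at most $d$. Then $n_0=1$, $n_1=d$, and for every $h\ge2$, $$n_h=\sum_{k=1}^{d}\binom{k+n_{h-1}-1}{k}\binom{d-k+n_0+\dots+n_{h-2}}{d-k}.$$
   Context: Trees are finite unordered rooted trees. In a directed multigraph, $\mathrm{child}(v)$ is the multiset of heads of arcs leaving $v$ (with multiplicity), the outdegree is $\deg(v)=\#\mathrm{child}(v)$, and $h(v)=0$ if $v$ has no children, $1+\max_{u\in\mathrm{child}(v)}h(u)$ otherwise. An irredundant forest is a finite set of trees none of which is isomorphic to a subtree (vertex plus all descendants) of another. The DAG reduction $\mathcal{R}(F)$ has one vertex per isomorphism class of subtrees occurring in $F$, with, from the class of $T[v]$ to a class $c'$, as many arcs as $v$ has children $u$ with $T[u]\in c'$. An FDAG is a directed acyclic multigraph of the form $\mathcal{R}(F)$, $F$ an irredundant forest; equivalently a finite connected directed acyclic multigraph whose distinct vertices have distinct multisets of children. -}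

module Defs where

open import Data.Nat using (ℕ; zero; suc; _≤_; _⊔_)
open import Data.Fin using (Fin)
open import Data.List using (List; []; _∷_; length)
open import Data.List.Membership.Propositional using (_∈_)
open import Data.List.Relation.Binary.Pointwise using (Pointwise)
open import Data.List.Relation.Binary.Permutation.Propositional using (_↭_)
open import Data.Product using (Σ; _×_)
open import Data.Sum using (_⊎_)
open import Relation.Nullary using (¬_)
open import Relation.Binary.PropositionalEquality using (_≡_)
open import Relation.Binary.Construct.Closure.Transitive using (TransClosure)
open import Relation.Binary.Construct.Closure.ReflexiveTransitive using (Star)
open import Function.Definitions using (Injective)

-- A finite directed multigraph on vertex set Fin V:
-- child v is the multiset (as a list, taken up to permutation) of
-- heads of the arcs leaving v (with multiplicity).
record Multigraph : Set where
  field
    V     : ℕ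
    child : Fin V → List (Fin V)

module _ (G : Multigraph) where
  open Multigraph G

  Arc : Fin V → Fin V → Set
  Arc v u = u ∈ child v

  outdeg : Fin V → ℕ
  outdeg v = length (child v)

  Acyclic : Set
  Acyclic = ∀ v → ¬ TransClosure Arc v v

  Adjacent : Fin V → Fin V → Set
  Adjacent u v = Arc u v ⊎ Arc v u

  Connected : Set
  Connected = ∀ u v → Star Adjacent u v

  DistinctChildren : Set
  DistinctChildren = ∀ u v → child u ↭ child v → u ≡ v

  maxList : List ℕ → ℕ
  maxList []       = 0
  maxList (x ∷ xs) = x ⊔ maxList xs

  heightFrom : List ℕ → ℕ
  heightFrom []       = 0
  heightFrom (x ∷ xs) = suc (maxList (x ∷ xs))

  data HasHeight : Fin V → ℕ → Set where
    hasHeight : ∀ {v} (hs : List ℕ) →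
                Pointwise HasHeight (child v) hs →
                HasHeight v (heightFrom hs)

IsFDAG : Multigraph → Set
IsFDAG G = Acyclic G × Connected G × DistinctChildren G

OutdegAtMost : ℕ → Multigraph → Set
OutdegAtMost d G = ∀ v → outdeg G v ≤ d

AtLeastOfHeight : Multigraph → ℕ → ℕ → Set
AtLeastOfHeight G h m =
  Σ (Fin m → Fin (Multigraph.V G)) λ f →
    Injective _≡_ _≡_ f × (∀ i → HasHeight G (f i) h)

IsMaxCount : ℕ → ℕ → ℕ → Set
IsMaxCount d h m =
  Σ Multigraph (λ G → IsFDAG G × OutdegAtMost d G × AtLeastOfHeight G h m)
  × (∀ G → IsFDAG G → OutdegAtMost d G → ∀ k → AtLeastOfHeight G h k → k ≤ m)

-- In an FDAG a vertex is determined by the multiset of its children, so a vertex of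
-- height h + 1 and outdegree at most d is an admissible multiset: at most d vertices
-- of height at most h, at least one of them of height exactly h. Sorting admissible
-- multisets by the number k of children of height h, there are
-- C(k + n_h - 1, k) · C(d - k + n_0 + ... + n_(h-1), d - k) of them for each k, which
-- bounds n_(h+1) (by induction on the height, vertices with equal multisets of child
-- codes coincide). Conversely, adding at every height all admissible multisets of the
-- vertices built so far as new vertices gives an FDAG attaining the bound.

module Submission where

open import Defs
open import Algebra.Properties.CommutativeSemigroup using (x∙yz≈y∙xz)
open import Data.Empty using (⊥-elim)
open import Data.Fin using (Fin; zero; suc; splitAt; _↑ˡ_; _↑ʳ_; combine; remQuot)
open import Data.Fin.Properties
  using (splitAt-↑ˡ; splitAt-↑ʳ; splitAt⁻¹-↑ˡ; splitAt⁻¹-↑ʳ; remQuot-combine; combine-remQuot;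
         ↑ˡ-injective; ↑ʳ-injective; injective⇒≤)
  renaming (suc-injective to Fin-suc-injective)
open import Data.List using (List; []; _∷_; _++_; _∷ʳ_; map; mapMaybe; length; upTo)
open import Data.List.Membership.Propositional using (_∈_)
open import Data.List.Membership.Propositional.Properties using (∈-map⁻; ∈-map⁺; ∈-upTo⁻; ∈-upTo⁺)
open import Data.List.Properties
  using (map-id; map-∘; map-cong; ∷-injective; length-map; length-++; length-upTo; upTo-∷ʳ;
         mapMaybe-++; mapMaybe-map-retract; mapMaybe-map-none; ++-identityʳ)
open import Data.List.Relation.Binary.Permutation.Propositional as ↭
  using (_↭_; prep; swap; ↭-refl; ↭-sym; ↭-trans; ↭-reflexive)
open import Data.List.Relation.Binary.Permutation.Propositional.Properties
  using (map⁺; ↭-map-inv; ↭-length; ∈-resp-↭; drop-∷; All-resp-↭; mapMaybe-↭; shift; ++⁺; ∷↭∷ʳ)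
open import Data.List.Relation.Binary.Pointwise using (Pointwise; []; _∷_; Pointwise-length)
open import Data.List.Relation.Unary.All as All using (All; []; _∷_)
import Data.List.Relation.Unary.All.Properties as All
open import Data.List.Relation.Unary.AllPairs using ([]; _∷_)
open import Data.List.Relation.Unary.Any using (here; there)
open import Data.List.Relation.Unary.Unique.Propositional using (Unique)
import Data.List.Relation.Unary.Unique.Propositional.Properties as Unique
open import Data.Nat
  using (ℕ; zero; suc; _+_; _*_; _∸_; _≤_; _<_; _≤′_; ≤′-refl; ≤′-step; z≤n; s≤s; s≤s⁻¹; _⊔_)
open import Data.Nat.Combinatorics using (_C_; nCk+nC[k+1]≡[n+1]C[k+1]; k>n⇒nCk≡0; nCn≡1)
open import Data.Nat.ListAction using (sum)
open import Data.Nat.ListAction.Properties using (sum-↭)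
open import Data.Nat.Properties
  using (suc-injective; ≤-refl; ≤-reflexive; ≤-trans; ≤-antisym; <-trans; <-irrefl; n≤0⇒n≡0; n<1+n;
         m≤n⇒m≤1+n; m≤n⇒m<n∨m≡n; m<n⇒m<1+n; ≤⇒≤′; +-identityʳ; +-suc; +-comm; +-mono-≤;
         m+[n∸m]≡n; m+n∸n≡m; m+n≤o⇒m≤o; m+n≤o⇒m≤o∸n; ⊔-lub; ⊔-sel; ⊔-identityʳ; m≤m⊔n; m≤n⊔m;
         ⊔-commutativeSemigroup; module ≤-Reasoning)
open import Data.Product using (Σ; ∃; ∃₂; _×_; _,_; proj₁; proj₂; uncurry)
open import Data.Product.Properties using (Σ-≡,≡←≡)
open import Data.Sum using (_⊎_; inj₁; inj₂; [_,_]′; isInj₁; isInj₂)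
import Data.Sum as Sum
open import Function using (_∘_; id)
open import Function.Definitions using (Injective)
open import Relation.Binary.Construct.Closure.ReflexiveTransitive using (Star; ε; _◅_; _◅◅_; reverse)
open import Relation.Binary.Construct.Closure.Transitive using (TransClosure; [_]; _∷_)
open import Relation.Binary.PropositionalEquality
  using (_≡_; _≢_; refl; sym; trans; cong; cong₂; subst; subst₂; module ≡-Reasoning)
open import Relation.Nullary using (¬_)
open import Relation.Unary using (_∪_; _⊆′_)

private
  variable
    A B D : Set

↭-map-reflect : ∀ (f : A → B) (g : A → D) {xs ys} →
  All (λ x → ∀ y → f x ≡ f y → g x ≡ g y) xs →
  map f xs ↭ map f ys → map g xs ↭ map g ys
↭-map-reflect f g {xs} {ys} f⇒g p with ↭-map-inv f p
... | zs , fys≡fzs , xs↭zs =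
  ↭-trans (map⁺ g xs↭zs) (↭-reflexive (transfer zs ys (All-resp-↭ xs↭zs f⇒g) (sym fys≡fzs)))
  where
  transfer : ∀ xs ys → All (λ x → ∀ y → f x ≡ f y → g x ≡ g y) xs →
             map f xs ≡ map f ys → map g xs ≡ map g ys
  transfer []       []       _          _ = refl
  transfer (x ∷ xs) (y ∷ ys) (fx⇒ ∷ fs) e =
    cong₂ _∷_ (fx⇒ y (proj₁ (∷-injective e))) (transfer xs ys fs (proj₂ (∷-injective e)))

↭-map-injective : ∀ {f : A → B} → Injective _≡_ _≡_ f →
                  ∀ {xs ys} → map f xs ↭ map f ys → xs ↭ ys
↭-map-injective {f = f} inj {xs} {ys} p =
  subst₂ _↭_ (map-id xs) (map-id ys) (↭-map-reflect f id (All.universal (λ _ _ → inj) xs) p)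

data SplitView (m n : ℕ) : Fin (m + n) → Set where
  left  : (i : Fin m) → SplitView m n (i ↑ˡ n)
  right : (j : Fin n) → SplitView m n (m ↑ʳ j)

splitView : ∀ m {n} (k : Fin (m + n)) → SplitView m n k
splitView m {n} k with splitAt m k in eq
... | inj₁ i = subst (SplitView m n) (splitAt⁻¹-↑ˡ eq) (left i)
... | inj₂ j = subst (SplitView m n) (splitAt⁻¹-↑ʳ eq) (right j)

↑ˡ≢↑ʳ : ∀ {m n} {i : Fin m} {j : Fin n} → i ↑ˡ n ≢ m ↑ʳ j
↑ˡ≢↑ʳ {m} {n} {i} {j} e
  with trans (sym (splitAt-↑ˡ m i n)) (trans (cong (splitAt m) e) (splitAt-↑ʳ m n j))
... | ()

glue : ∀ {a b} → List (Fin a) → List (Fin b) → List (Fin (a + b))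
glue {a} {b} xs ys = map (_↑ˡ b) xs ++ map (a ↑ʳ_) ys

module _ (a : ℕ) {b : ℕ} where

  tops : List (Fin (a + b)) → List (Fin a)
  tops = mapMaybe (isInj₁ ∘ splitAt a)

  lows : List (Fin (a + b)) → List (Fin b)
  lows = mapMaybe (isInj₂ ∘ splitAt a)

  ↭-glue-tops-lows : (zs : List (Fin (a + b))) → zs ↭ glue (tops zs) (lows zs)
  ↭-glue-tops-lows []       = ↭-refl
  ↭-glue-tops-lows (z ∷ zs) with splitView a z
  ... | left i  rewrite splitAt-↑ˡ a i b = prep _ (↭-glue-tops-lows zs)
  ... | right j rewrite splitAt-↑ʳ a b j =
    ↭-trans (prep _ (↭-glue-tops-lows zs)) (↭-sym (shift _ (map (_↑ˡ b) (tops zs)) _))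

  length-tops-lows : (zs : List (Fin (a + b))) → length zs ≡ length (tops zs) + length (lows zs)
  length-tops-lows zs = begin
    length zs                                                       ≡⟨ ↭-length (↭-glue-tops-lows zs) ⟩
    length (map (_↑ˡ b) (tops zs) ++ map (a ↑ʳ_) (lows zs))         ≡⟨ length-++ (map (_↑ˡ b) (tops zs)) ⟩
    length (map (_↑ˡ b) (tops zs)) + length (map (a ↑ʳ_) (lows zs)) ≡⟨ cong₂ _+_ (length-map _ (tops zs))
                                                                                   (length-map _ (lows zs)) ⟩
    length (tops zs) + length (lows zs)                             ∎
    where open ≡-Reasoning

  tops-nonempty⁻ : ∀ {zs : List (Fin (a + b))} → 0 < length (tops zs) → ∃ λ i → i ↑ˡ b ∈ zs
  tops-nonempty⁻ {zs} p with tops zs | ↭-glue-tops-lows zs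
  ... | t ∷ _ | zs↭ = t , ∈-resp-↭ (↭-sym zs↭) (here refl)

  tops-nonempty⁺ : ∀ {i} (zs : List (Fin (a + b))) → i ↑ˡ b ∈ zs → 0 < length (tops zs)
  tops-nonempty⁺ (z ∷ zs) i∈ with splitView a z | i∈
  ... | left i  | _         rewrite splitAt-↑ˡ a i b = s≤s z≤n
  ... | right j | here e    = ⊥-elim (↑ˡ≢↑ʳ e)
  ... | right j | there i∈′ rewrite splitAt-↑ʳ a b j = tops-nonempty⁺ zs i∈′

module _ {a b : ℕ} where

  tops-glue : (xs : List (Fin a)) (ys : List (Fin b)) → tops a (glue xs ys) ≡ xs
  tops-glue xs ys = begin
    tops a (map (_↑ˡ b) xs ++ map (a ↑ʳ_) ys)
      ≡⟨ mapMaybe-++ _ (map (_↑ˡ b) xs) _ ⟩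
    tops a (map (_↑ˡ b) xs) ++ tops a (map (a ↑ʳ_) ys)
      ≡⟨ cong₂ _++_ (mapMaybe-map-retract (λ i → cong isInj₁ (splitAt-↑ˡ a i b)) xs)
                    (mapMaybe-map-none (λ j → cong isInj₁ (splitAt-↑ʳ a b j)) ys) ⟩
    xs ++ []
      ≡⟨ ++-identityʳ xs ⟩
    xs ∎
    where open ≡-Reasoning

  lows-glue : (xs : List (Fin a)) (ys : List (Fin b)) → lows a (glue xs ys) ≡ ys
  lows-glue xs ys = begin
    lows a (map (_↑ˡ b) xs ++ map (a ↑ʳ_) ys)
      ≡⟨ mapMaybe-++ _ (map (_↑ˡ b) xs) _ ⟩
    lows a (map (_↑ˡ b) xs) ++ lows a (map (a ↑ʳ_) ys)
      ≡⟨ cong₂ _++_ (mapMaybe-map-none (λ i → cong isInj₂ (splitAt-↑ˡ a i b)) xs)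
                    (mapMaybe-map-retract (λ j → cong isInj₂ (splitAt-↑ʳ a b j)) ys) ⟩
    ys ∎
    where open ≡-Reasoning

  glue-↭ : ∀ {xs xs′ : List (Fin a)} {ys ys′ : List (Fin b)} →
           xs ↭ xs′ → ys ↭ ys′ → glue xs ys ↭ glue xs′ ys′
  glue-↭ p q = ++⁺ (map⁺ _ p) (map⁺ _ q)

  glue-reflect : ∀ {xs xs′ : List (Fin a)} {ys ys′ : List (Fin b)} →
                 glue xs ys ↭ glue xs′ ys′ → xs ↭ xs′ × ys ↭ ys′
  glue-reflect {xs} {xs′} {ys} {ys′} p =
    subst₂ _↭_ (tops-glue xs ys) (tops-glue xs′ ys′) (mapMaybe-↭ _ p) ,
    subst₂ _↭_ (lows-glue xs ys) (lows-glue xs′ ys′) (mapMaybe-↭ _ p)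

-- Enumerations of multisets

-- Lists are taken up to permutation: elem is a bijection from Fin size onto the
-- multisets satisfying P.
record Enumeration {A : Set} (P : List A → Set) : Set where
  field
    size           : ℕ
    elem           : Fin size → List A
    elem-sat       : ∀ i → P (elem i)
    index          : ∀ {xs} → P xs → Fin size
    ↭-elem-index   : ∀ {xs} (p : P xs) → xs ↭ elem (index p)
    elem-injective : ∀ {i j} → elem i ↭ elem j → i ≡ j

open Enumeration

module _ {A : Set} where

  _⊆↭_ : (List A → Set) → (List A → Set) → Set
  P ⊆↭ Q = ∀ xs → P xs → ∃ λ ys → xs ↭ ys × Q ys

  transport : ∀ {P Q : List A → Set} → Enumeration P → P ⊆′ Q → Q ⊆↭ P → Enumeration Q
  transport e P⊆Q Q⊆↭P = record
    { size           = size e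
    ; elem           = elem e
    ; elem-sat       = λ i → P⊆Q _ (elem-sat e i)
    ; index          = λ q → index e (proj₂ (proj₂ (Q⊆↭P _ q)))
    ; ↭-elem-index   = λ q → let _ , xs↭ys , p = Q⊆↭P _ q in ↭-trans xs↭ys (↭-elem-index e p)
    ; elem-injective = elem-injective e
    }

  none : ∀ {P : List A → Set} → (∀ {xs} → ¬ P xs) → Enumeration P
  none ¬P = record
    { size           = 0
    ; elem           = λ ()
    ; elem-sat       = λ ()
    ; index          = ⊥-elim ∘ ¬P
    ; ↭-elem-index   = ⊥-elim ∘ ¬P
    ; elem-injective = λ { {()} }
    }

  nil : Enumeration {A} (λ xs → length xs ≡ 0)
  nil = record
    { size           = 1
    ; elem           = λ _ → []
    ; elem-sat       = λ _ → refl
    ; index          = λ _ → zero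
    ; ↭-elem-index   = λ { {[]} _ → ↭-refl }
    ; elem-injective = λ { {zero} {zero} _ → refl }
    }

  union : ∀ {P Q : List A → Set} → (∀ {xs ys} → P xs → Q ys → ¬ (xs ↭ ys)) →
          Enumeration P → Enumeration Q → Enumeration (P ∪ Q)
  union {P} {Q} disjoint e f = record
    { size           = size e + size f
    ; elem           = elem′
    ; elem-sat       = elem′-sat
    ; index          = [ (λ p → index e p ↑ˡ size f) , (λ q → size e ↑ʳ index f q) ]′
    ; ↭-elem-index   = λ { (inj₁ p) → subst (_ ↭_) (sym (elem′-↑ˡ _)) (↭-elem-index e p)
                         ; (inj₂ q) → subst (_ ↭_) (sym (elem′-↑ʳ _)) (↭-elem-index f q) }
    ; elem-injective = elem′-injective
    }
    where
    elem′ : Fin (size e + size f) → List A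
    elem′ = [ elem e , elem f ]′ ∘ splitAt (size e)

    elem′-↑ˡ : ∀ i → elem′ (i ↑ˡ size f) ≡ elem e i
    elem′-↑ˡ i rewrite splitAt-↑ˡ (size e) i (size f) = refl

    elem′-↑ʳ : ∀ j → elem′ (size e ↑ʳ j) ≡ elem f j
    elem′-↑ʳ j rewrite splitAt-↑ʳ (size e) (size f) j = refl

    elem′-sat : ∀ k → (P ∪ Q) (elem′ k)
    elem′-sat k with splitView (size e) k
    ... | left i  rewrite elem′-↑ˡ i = inj₁ (elem-sat e i)
    ... | right j rewrite elem′-↑ʳ j = inj₂ (elem-sat f j)

    elem′-injective : ∀ {k l} → elem′ k ↭ elem′ l → k ≡ l
    elem′-injective {k} {l} p with splitView (size e) k | splitView (size e) l
    ... | left i  | left i′  rewrite elem′-↑ˡ i | elem′-↑ˡ i′ = cong (_↑ˡ size f) (elem-injective e p)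
    ... | right j | right j′ rewrite elem′-↑ʳ j | elem′-↑ʳ j′ = cong (size e ↑ʳ_) (elem-injective f p)
    ... | left i  | right j  rewrite elem′-↑ˡ i | elem′-↑ʳ j  =
      ⊥-elim (disjoint (elem-sat e i) (elem-sat f j) p)
    ... | right j | left i   rewrite elem′-↑ʳ j | elem′-↑ˡ i  =
      ⊥-elim (disjoint (elem-sat e i) (elem-sat f j) (↭-sym p))

Image : (List A → List B) → (List A → Set) → List B → Set
Image g P zs = ∃ λ xs → P xs × zs ≡ g xs

Image₂ : (List A → List B → List D) → (List A → Set) → (List B → Set) → List D → Set
Image₂ g P Q zs = ∃₂ λ xs ys → P xs × Q ys × zs ≡ g xs ys

module _ {A B : Set} (g : List A → List B)
         (g-↭ : ∀ {xs ys} → xs ↭ ys → g xs ↭ g ys)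
         (g-reflect : ∀ {xs ys} → g xs ↭ g ys → xs ↭ ys) where

  image : ∀ {P : List A → Set} → Enumeration P → Enumeration (Image g P)
  image e = record
    { size           = size e
    ; elem           = g ∘ elem e
    ; elem-sat       = λ i → elem e i , elem-sat e i , refl
    ; index          = λ (_ , p , _) → index e p
    ; ↭-elem-index   = λ { (_ , p , refl) → g-↭ (↭-elem-index e p) }
    ; elem-injective = elem-injective e ∘ g-reflect
    }

module _ {A B D : Set} (g : List A → List B → List D)
         (g-↭ : ∀ {xs xs′ ys ys′} → xs ↭ xs′ → ys ↭ ys′ → g xs ys ↭ g xs′ ys′)
         (g-reflect : ∀ {xs xs′ ys ys′} → g xs ys ↭ g xs′ ys′ → xs ↭ xs′ × ys ↭ ys′) where

  product : ∀ {P : List A → Set} {Q : List B → Set} → Enumeration P → Enumeration Q →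
            Enumeration (Image₂ g P Q)
  product e f = record
    { size           = size e * size f
    ; elem           = elem′
    ; elem-sat       = λ _ → _ , _ , elem-sat e _ , elem-sat f _ , refl
    ; index          = λ (_ , _ , p , q , _) → combine (index e p) (index f q)
    ; ↭-elem-index   = λ { (xs , ys , p , q , refl) →
        subst (g xs ys ↭_) (sym (elem′-combine (index e p) (index f q)))
              (g-↭ (↭-elem-index e p) (↭-elem-index f q)) }
    ; elem-injective = elem′-injective
    }
    where
    elem′ : Fin (size e * size f) → List D
    elem′ = uncurry (λ i j → g (elem e i) (elem f j)) ∘ remQuot {size e} (size f)

    elem′-combine : ∀ i j → elem′ (combine i j) ≡ g (elem e i) (elem f j)
    elem′-combine i j = cong (uncurry (λ i j → g (elem e i) (elem f j))) (remQuot-combine i j)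

    pair-injective : ∀ {i i′ j j′} → g (elem e i) (elem f j) ↭ g (elem e i′) (elem f j′) →
                     (i , j) ≡ (i′ , j′)
    pair-injective p =
      cong₂ _,_ (elem-injective e (proj₁ (g-reflect p))) (elem-injective f (proj₂ (g-reflect p)))

    elem′-injective : ∀ {k l} → elem′ k ↭ elem′ l → k ≡ l
    elem′-injective {k} {l} p = begin
      k                                             ≡⟨ combine-remQuot {size e} (size f) k ⟨
      uncurry combine (remQuot {size e} (size f) k) ≡⟨ cong (uncurry combine) (pair-injective p) ⟩
      uncurry combine (remQuot {size e} (size f) l) ≡⟨ combine-remQuot {size e} (size f) l ⟩
      l                                             ∎
      where open ≡-Reasoning

Union : (ℕ → List A → Set) → List ℕ → List A → Set
Union P ks xs = ∃ λ k → k ∈ ks × P k xs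

module _ {A : Set} {P : ℕ → List A → Set} (key : List A → ℕ)
         (key-↭ : ∀ {xs ys} → xs ↭ ys → key xs ≡ key ys)
         (key-P : ∀ {k xs} → P k xs → key xs ≡ k)
         (e : ∀ k → Enumeration (P k)) where

  ⋃ : ∀ ks → Unique ks → Enumeration (Union P ks)
  ⋃ []       []          = none λ ()
  ⋃ (k ∷ ks) (k∉ks ∷ u) = transport (union disjoint (e k) (⋃ ks u)) sound complete
    where
    disjoint : ∀ {xs ys} → P k xs → Union P ks ys → ¬ (xs ↭ ys)
    disjoint p (k′ , k′∈ks , p′) xs↭ys =
      All.lookup k∉ks k′∈ks (trans (sym (key-P p)) (trans (key-↭ xs↭ys) (key-P p′)))

    sound : (P k ∪ Union P ks) ⊆′ Union P (k ∷ ks)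
    sound _ (inj₁ p)               = k , here refl , p
    sound _ (inj₂ (k′ , k′∈ks , p)) = k′ , there k′∈ks , p

    complete : Union P (k ∷ ks) ⊆↭ (P k ∪ Union P ks)
    complete _ (k′ , here refl    , p) = _ , ↭-refl , inj₁ p
    complete _ (k′ , there k′∈ks , p) = _ , ↭-refl , inj₂ (k′ , k′∈ks , p)

  size-⋃ : ∀ ks (u : Unique ks) → size (⋃ ks u) ≡ sum (map (size ∘ e) ks)
  size-⋃ []       []       = refl
  size-⋃ (k ∷ ks) (_ ∷ u) = cong (size (e k) +_) (size-⋃ ks u)

zero∈-or-map-suc : ∀ {a} (xs : List (Fin (suc a))) →
                   (∃ λ ys → xs ↭ zero ∷ ys) ⊎ (∃ λ ys → xs ≡ map suc ys)
zero∈-or-map-suc []           = inj₂ ([] , refl)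
zero∈-or-map-suc (zero  ∷ xs) = inj₁ (xs , ↭-refl)
zero∈-or-map-suc (suc x ∷ xs) with zero∈-or-map-suc xs
... | inj₁ (ys , p)    = inj₁ (suc x ∷ ys , ↭-trans (prep (suc x) p) (swap (suc x) zero ↭-refl))
... | inj₂ (ys , refl) = inj₂ (x ∷ ys , refl)

exact : ∀ a k → Enumeration {Fin a} (λ xs → length xs ≡ k)
exact a       zero    = nil
exact zero    (suc k) = none λ { {[]} () ; {() ∷ _} }
exact (suc a) (suc k) = transport
  (union disjoint (image (map suc) (map⁺ suc) (↭-map-injective Fin-suc-injective) (exact a (suc k)))
                  (image (zero ∷_) (prep zero) drop-∷ (exact (suc a) k)))
  sound complete
  where
  Shifted Rooted : List (Fin (suc a)) → Set
  Shifted = Image (map suc) (λ xs → length xs ≡ suc k)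
  Rooted  = Image (zero ∷_) (λ xs → length xs ≡ k)

  disjoint : ∀ {xs ys} → Shifted xs → Rooted ys → ¬ (xs ↭ ys)
  disjoint (_ , _ , refl) (_ , _ , refl) p with ∈-map⁻ suc (∈-resp-↭ (↭-sym p) (here refl))
  ... | _ , _ , ()

  sound : (Shifted ∪ Rooted) ⊆′ (λ xs → length xs ≡ suc k)
  sound _ (inj₁ (xs , e , refl)) = trans (length-map suc xs) e
  sound _ (inj₂ (_  , e , refl)) = cong suc e

  complete : (λ xs → length xs ≡ suc k) ⊆↭ (Shifted ∪ Rooted)
  complete xs e with zero∈-or-map-suc xs
  ... | inj₁ (ys , p)    = _ , p , inj₂ (ys , suc-injective (trans (sym (↭-length p)) e) , refl)
  ... | inj₂ (ys , refl) = _ , ↭-refl , inj₁ (ys , trans (sym (length-map suc ys)) e , refl)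

atMost : ∀ b m → Enumeration {Fin b} (λ xs → length xs ≤ m)
atMost b zero    = transport (exact b 0) (λ _ → ≤-reflexive) (λ xs xs≤0 → xs , ↭-refl , n≤0⇒n≡0 xs≤0)
atMost b (suc m) = transport (union disjoint (atMost b m) (exact b (suc m))) sound complete
  where
  Short Full : List (Fin b) → Set
  Short xs = length xs ≤ m
  Full  xs = length xs ≡ suc m

  disjoint : ∀ {xs ys} → Short xs → Full ys → ¬ (xs ↭ ys)
  disjoint xs≤m ys≡1+m p = <-irrefl (trans (↭-length p) ys≡1+m) (s≤s xs≤m)

  sound : (Short ∪ Full) ⊆′ (λ xs → length xs ≤ suc m)
  sound _ (inj₁ xs≤m)   = m≤n⇒m≤1+n xs≤m
  sound _ (inj₂ xs≡1+m) = ≤-reflexive xs≡1+m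

  complete : (λ xs → length xs ≤ suc m) ⊆↭ (Short ∪ Full)
  complete xs xs≤1+m with m≤n⇒m<n∨m≡n xs≤1+m
  ... | inj₁ (s≤s xs≤m) = xs , ↭-refl , inj₁ xs≤m
  ... | inj₂ xs≡1+m     = xs , ↭-refl , inj₂ xs≡1+m

size-exact : ∀ a k → size (exact a k) ≡ (k + a ∸ 1) C k
size-exact a       zero    = refl
size-exact zero    (suc k) = sym (k>n⇒nCk≡0 (subst (_< suc k) (sym (+-identityʳ k)) (n<1+n k)))
size-exact (suc a) (suc k) = begin
  size (exact a (suc k)) + size (exact (suc a) k) ≡⟨ cong₂ _+_ (size-exact a (suc k)) (size-exact (suc a) k) ⟩
  (k + a) C suc k + (k + suc a ∸ 1) C k           ≡⟨ cong (λ n → (k + a) C suc k + (n ∸ 1) C k) (+-suc k a) ⟩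
  (k + a) C suc k + (k + a) C k                   ≡⟨ +-comm ((k + a) C suc k) _ ⟩
  (k + a) C k + (k + a) C suc k                   ≡⟨ nCk+nC[k+1]≡[n+1]C[k+1] (k + a) k ⟩
  suc (k + a) C suc k                             ≡⟨ cong (λ n → (n ∸ 1) C suc k) (+-suc (suc k) a) ⟨
  (suc k + suc a ∸ 1) C suc k                     ∎
  where open ≡-Reasoning

size-atMost : ∀ b m → size (atMost b m) ≡ (m + b) C m
size-atMost b zero    = refl
size-atMost b (suc m) = begin
  size (atMost b m) + size (exact b (suc m)) ≡⟨ cong₂ _+_ (size-atMost b m) (size-exact b (suc m)) ⟩
  (m + b) C m + (m + b) C suc m              ≡⟨ nCk+nC[k+1]≡[n+1]C[k+1] (m + b) m ⟩
  suc (m + b) C suc m                        ∎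
  where open ≡-Reasoning

-- Over Fin (a + b), Fin a stands for the vertices of the top height and Fin b for the
-- lower ones; Admissible lists the possible child multisets of a new vertex.
module _ (d : ℕ) where

  Admissible : ∀ a {b} → List (Fin (a + b)) → Set
  Admissible a {b} zs = length zs ≤ d × ∃ λ i → i ↑ˡ b ∈ zs

  Slice : ∀ a {b} → ℕ → List (Fin (a + b)) → Set
  Slice a k zs = length (tops a zs) ≡ k × length (lows a zs) ≤ d ∸ k

  slice : ∀ a b k → Enumeration (Slice a {b} k)
  slice a b k =
    transport (product glue glue-↭ glue-reflect (exact a k) (atMost b (d ∸ k))) sound complete
    where
    sound : Image₂ glue (λ xs → length xs ≡ k) (λ ys → length ys ≤ d ∸ k) ⊆′ Slice a k
    sound _ (xs , ys , xs≡k , ys≤d∸k , refl) =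
      trans (cong length (tops-glue xs ys)) xs≡k ,
      subst (λ ys → length ys ≤ d ∸ k) (sym (lows-glue xs ys)) ys≤d∸k

    complete : Slice a k ⊆↭ Image₂ glue (λ xs → length xs ≡ k) (λ ys → length ys ≤ d ∸ k)
    complete zs (tops≡k , lows≤d∸k) =
      _ , ↭-glue-tops-lows a zs , tops a zs , lows a zs , tops≡k , lows≤d∸k , refl

  ranks : List ℕ
  ranks = map suc (upTo d)

  ∈-ranks⁻ : ∀ {k} → k ∈ ranks → 0 < k × k ≤ d
  ∈-ranks⁻ k∈ with ∈-map⁻ suc k∈
  ... | _ , j∈ , refl = s≤s z≤n , ∈-upTo⁻ j∈

  ∈-ranks⁺ : ∀ {k} → 0 < k → k ≤ d → k ∈ ranks
  ∈-ranks⁺ {suc j} _ k≤d = ∈-map⁺ suc (∈-upTo⁺ k≤d)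

  admissible : ∀ a b → Enumeration (Admissible a {b})
  admissible a b = transport
    (⋃ (length ∘ tops a) (↭-length ∘ mapMaybe-↭ _) proj₁ (slice a b)
       ranks (Unique.map⁺ suc-injective (Unique.upTo⁺ d)))
    sound complete
    where
    sound : Union (Slice a) ranks ⊆′ Admissible a
    sound zs (k , k∈ranks , tops≡k , lows≤d∸k) =
      length≤d , tops-nonempty⁻ a (subst (0 <_) (sym tops≡k) (proj₁ (∈-ranks⁻ k∈ranks)))
      where
      length≤d : length zs ≤ d
      length≤d = begin
        length zs                               ≡⟨ length-tops-lows a zs ⟩
        length (tops a zs) + length (lows a zs) ≤⟨ +-mono-≤ (≤-reflexive tops≡k) lows≤d∸k ⟩
        k + (d ∸ k)                             ≡⟨ m+[n∸m]≡n (proj₂ (∈-ranks⁻ k∈ranks)) ⟩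
        d                                       ∎
        where open ≤-Reasoning

    complete : Admissible a ⊆↭ Union (Slice a) ranks
    complete zs (length≤d , _ , i∈zs) =
      zs , ↭-refl , _ , ∈-ranks⁺ (tops-nonempty⁺ a zs i∈zs) tops≤d , refl , lows≤d∸tops
      where
      t l : ℕ
      t = length (tops a zs)
      l = length (lows a zs)

      t+l≤d : t + l ≤ d
      t+l≤d = subst (_≤ d) (length-tops-lows a zs) length≤d

      tops≤d : t ≤ d
      tops≤d = m+n≤o⇒m≤o t t+l≤d

      lows≤d∸tops : l ≤ d ∸ t
      lows≤d∸tops = m+n≤o⇒m≤o∸n l (subst (_≤ d) (+-comm t l) t+l≤d)

  size-admissible : ∀ a b →
    size (admissible a b) ≡ sum (map (λ k → ((k + a ∸ 1) C k) * ((d ∸ k + b) C (d ∸ k))) ranks)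
  size-admissible a b = trans (size-⋃ _ _ _ (slice a b) ranks _)
    (cong sum (map-cong (λ k → cong₂ _*_ (size-exact a k) (size-atMost b (d ∸ k))) ranks))

-- Heights

pointwise-map : ∀ {R : A → B → Set} (f : A → B) {xs} →
                (∀ {x} → x ∈ xs → R x (f x)) → Pointwise R xs (map f xs)
pointwise-map f {[]}     _ = []
pointwise-map f {x ∷ xs} r = r (here refl) ∷ pointwise-map f (r ∘ there)

Pointwise-[]ʳ : ∀ {R : A → B → Set} {xs} → Pointwise R xs [] → xs ≡ []
Pointwise-[]ʳ [] = refl

heightFrom-cong : ∀ G G′ hs → heightFrom G hs ≡ heightFrom G′ hs
heightFrom-cong G G′ []       = refl
heightFrom-cong G G′ (h ∷ hs) = cong suc (maxList-cong h hs)
  where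
  maxList-cong : ∀ h hs → maxList G (h ∷ hs) ≡ maxList G′ (h ∷ hs)
  maxList-cong h []        = refl
  maxList-cong h (h′ ∷ hs) = cong (h ⊔_) (maxList-cong h′ hs)

module _ (G : Multigraph) where

  maxList-upper : ∀ hs → All (_≤ maxList G hs) hs
  maxList-upper []       = []
  maxList-upper (h ∷ hs) = m≤m⊔n h _ ∷ All.map (λ h′≤ → ≤-trans h′≤ (m≤n⊔m h _)) (maxList-upper hs)

  maxList-least : ∀ {m hs} → All (_≤ m) hs → maxList G hs ≤ m
  maxList-least []       = z≤n
  maxList-least (b ∷ bs) = ⊔-lub b (maxList-least bs)

  maxList-∈ : ∀ h hs → maxList G (h ∷ hs) ∈ h ∷ hs
  maxList-∈ h []        = here (⊔-identityʳ h)
  maxList-∈ h (h′ ∷ hs) with ⊔-sel h (maxList G (h′ ∷ hs))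
  ... | inj₁ e = here e
  ... | inj₂ e = there (subst (_∈ h′ ∷ hs) (sym e) (maxList-∈ h′ hs))

  maxList-↭ : ∀ {hs hs′} → hs ↭ hs′ → maxList G hs ≡ maxList G hs′
  maxList-↭ ↭.refl          = refl
  maxList-↭ (↭.prep h p)    = cong (h ⊔_) (maxList-↭ p)
  maxList-↭ (↭.swap h h′ p) =
    trans (cong (λ m → h ⊔ (h′ ⊔ m)) (maxList-↭ p)) (x∙yz≈y∙xz ⊔-commutativeSemigroup h h′ _)
  maxList-↭ (↭.trans p q)   = trans (maxList-↭ p) (maxList-↭ q)

  heightFrom-↭ : ∀ {hs hs′} → hs ↭ hs′ → heightFrom G hs ≡ heightFrom G hs′
  heightFrom-↭ {[]}    {[]}    _ = refl
  heightFrom-↭ {_ ∷ _} {_ ∷ _} p = cong suc (maxList-↭ p)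
  heightFrom-↭ {[]}    {_ ∷ _} p with ↭-length p
  ... | ()
  heightFrom-↭ {_ ∷ _} {[]}    p with ↭-length p
  ... | ()

  <-heightFrom : ∀ {h hs} → h ∈ hs → h < heightFrom G hs
  <-heightFrom {hs = h′ ∷ hs} h∈ = s≤s (All.lookup (maxList-upper (h′ ∷ hs)) h∈)

  heightFrom≡suc : ∀ {m hs} → All (_≤ m) hs → m ∈ hs → heightFrom G hs ≡ suc m
  heightFrom≡suc {hs = h ∷ hs} bs m∈ =
    cong suc (≤-antisym (maxList-least bs) (All.lookup (maxList-upper (h ∷ hs)) m∈))

module Levelled (G : Multigraph) (level : Fin (Multigraph.V G) → ℕ)
                (level-eq : ∀ v → level v ≡ heightFrom G (map level (Multigraph.child G v))) where
  open Multigraph G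

  level-child< : ∀ {v u} → Arc G v u → level u < level v
  level-child< {v} u∈ = subst (level _ <_) (sym (level-eq v)) (<-heightFrom G (∈-map⁺ level u∈))

  acyclic : Acyclic G
  acyclic v cycle = <-irrefl refl (descent cycle)
    where
    descent : ∀ {v w} → TransClosure (Arc G) v w → level w < level v
    descent [ a ]   = level-child< a
    descent (a ∷ t) = <-trans (descent t) (level-child< a)

  hasHeight-level : ∀ v → HasHeight G v (level v)
  hasHeight-level v = below (suc (level v)) v ≤-refl
    where
    below : ∀ k v → level v < k → HasHeight G v (level v)
    below (suc k) v (s≤s v≤k) = subst (HasHeight G v) (sym (level-eq v))
      (hasHeight _ (pointwise-map level (λ u∈ → below k _ (≤-trans (level-child< u∈) v≤k))))

  reaches-leaf : ∀ v → ∃ λ ℓ → child ℓ ≡ [] × Star (Adjacent G) v ℓ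
  reaches-leaf v = descend (suc (level v)) v ≤-refl
    where
    descend : ∀ k v → level v < k → ∃ λ ℓ → child ℓ ≡ [] × Star (Adjacent G) v ℓ
    descend (suc k) v (s≤s v≤k) with child v in eq
    ... | []    = v , eq , ε
    ... | u ∷ _ =
      let ℓ , ℓ-leaf , u⇝ℓ = descend k u (≤-trans (level-child< u∈) v≤k)
      in  ℓ , ℓ-leaf , inj₁ u∈ ◅ u⇝ℓ
      where
      u∈ : u ∈ child v
      u∈ = subst (u ∈_) (sym eq) (here refl)

  connected : DistinctChildren G → Connected G
  connected distinct u v with reaches-leaf u | reaches-leaf v
  ... | ℓ , ℓ-leaf , u⇝ℓ | ℓ′ , ℓ′-leaf , v⇝ℓ′ =
    u⇝ℓ ◅◅ subst (λ w → Star (Adjacent G) w v)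
                 (distinct ℓ′ ℓ (↭-reflexive (trans ℓ′-leaf (sym ℓ-leaf))))
                 (reverse Sum.swap v⇝ℓ′)

-- The extremal FDAG

-- The n j vertices of height j are numbered by Fin (n j). The vertices of height < j form
-- Fin (S j), highest level first, and a vertex of height j + 1 is an admissible
-- multiset of them.
module Canonical (d : ℕ) where

  mutual
    n : ℕ → ℕ
    n zero    = 1
    n (suc j) = size (admissible d (n j) (S j))

    S : ℕ → ℕ
    S zero    = 0
    S (suc j) = n j + S j

  Code : Set
  Code = Σ ℕ λ h → Fin (n h)

  decode : ∀ j → Fin (S j) → Code
  decode (suc j) x = [ (j ,_) , decode j ]′ (splitAt (n j) x)

  level : ∀ j → Fin (S j) → ℕ
  level j = proj₁ ∘ decode j

  decode-↑ˡ : ∀ j i → decode (suc j) (i ↑ˡ S j) ≡ (j , i)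
  decode-↑ˡ j i rewrite splitAt-↑ˡ (n j) i (S j) = refl

  decode-↑ʳ : ∀ j y → decode (suc j) (n j ↑ʳ y) ≡ decode j y
  decode-↑ʳ j y rewrite splitAt-↑ʳ (n j) (S j) y = refl

  level< : ∀ j y → level j y < j
  level< (suc j) y with splitView (n j) y
  ... | left i  rewrite decode-↑ˡ j i = ≤-refl
  ... | right z rewrite decode-↑ʳ j z = m<n⇒m<1+n (level< j z)

  top≢lift : ∀ j i z → level (suc j) (i ↑ˡ S j) ≢ level (suc j) (n j ↑ʳ z)
  top≢lift j i z e =
    <-irrefl (sym (trans (cong proj₁ (sym (decode-↑ˡ j i))) (trans e (cong proj₁ (decode-↑ʳ j z)))))
             (level< j z)

  embed : ∀ {h j} → h ≤′ j → Fin (n h) → Fin (S (suc j))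
  embed {j = j} ≤′-refl     x = x ↑ˡ S j
  embed (≤′-step {j} h≤′j) x = n (suc j) ↑ʳ embed h≤′j x

  decode-embed : ∀ {h j} (h≤′j : h ≤′ j) x → decode (suc j) (embed h≤′j x) ≡ (h , x)
  decode-embed {j = j} ≤′-refl x = decode-↑ˡ j x
  decode-embed (≤′-step {j} h≤′j) x = trans (decode-↑ʳ (suc j) (embed h≤′j x)) (decode-embed h≤′j x)

  map-level-lift : ∀ j (ys : List (Fin (S j))) →
                   map (level (suc j)) (map (n j ↑ʳ_) ys) ≡ map (level j) ys
  map-level-lift j ys = trans (sym (map-∘ ys)) (map-cong (cong proj₁ ∘ decode-↑ʳ j) ys)

  top-∈-levels : ∀ j {zs : List (Fin (S (suc j)))} →
                 (∃ λ i → i ↑ˡ S j ∈ zs) → j ∈ map (level (suc j)) zs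
  top-∈-levels j (i , i∈) = subst (_∈ _) (cong proj₁ (decode-↑ˡ j i)) (∈-map⁺ (level (suc j)) i∈)

  top-∈-levels⁻ : ∀ j {zs : List (Fin (S (suc j)))} →
                  j ∈ map (level (suc j)) zs → ∃ λ i → i ↑ˡ S j ∈ zs
  top-∈-levels⁻ j j∈ with ∈-map⁻ (level (suc j)) j∈
  ... | y , y∈ , j≡ with splitView (n j) y
  ...   | left i  = i , y∈
  ...   | right z = ⊥-elim (<-irrefl (sym (trans j≡ (cong proj₁ (decode-↑ʳ j z)))) (level< j z))

  levels≤ : ∀ j (zs : List (Fin (S (suc j)))) → All (_≤ j) (map (level (suc j)) zs)
  levels≤ j zs = All.map⁺ (All.universal (s≤s⁻¹ ∘ level< (suc j)) zs)

  topChildren : ∀ j → Fin (n j) → List (Fin (S j))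
  topChildren zero    _ = []
  topChildren (suc j)   = elem (admissible d (n j) (S j))

  children : ∀ j → Fin (S j) → List (Fin (S j))
  children (suc j) x = map (n j ↑ʳ_) ([ topChildren j , children j ]′ (splitAt (n j) x))

  canonical : ℕ → Multigraph
  canonical j = record { V = S j ; child = children j }

  children-↑ˡ : ∀ j i → children (suc j) (i ↑ˡ S j) ≡ map (n j ↑ʳ_) (topChildren j i)
  children-↑ˡ j i rewrite splitAt-↑ˡ (n j) i (S j) = refl

  children-↑ʳ : ∀ j y → children (suc j) (n j ↑ʳ y) ≡ map (n j ↑ʳ_) (children j y)
  children-↑ʳ j y rewrite splitAt-↑ʳ (n j) (S j) y = refl

  heightFrom-topChildren : ∀ G j i → heightFrom G (map (level j) (topChildren j i)) ≡ j
  heightFrom-topChildren G zero    i = refl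
  heightFrom-topChildren G (suc j) i =
    heightFrom≡suc G (levels≤ j _) (top-∈-levels j (proj₂ (elem-sat (admissible d (n j) (S j)) i)))

  level-eq : ∀ j x → level j x ≡ heightFrom (canonical j) (map (level j) (children j x))
  level-eq (suc j) x with splitView (n j) x
  ... | left i = begin
    level (suc j) (i ↑ˡ S j)                                 ≡⟨ cong proj₁ (decode-↑ˡ j i) ⟩
    j                                                        ≡⟨ heightFrom-topChildren G j i ⟨
    heightFrom G (map (level j) (topChildren j i))           ≡⟨ cong (heightFrom G) (map-level-lift j _) ⟨
    heightFrom G (map (level (suc j)) (map (n j ↑ʳ_) (topChildren j i)))
      ≡⟨ cong (heightFrom G ∘ map (level (suc j))) (children-↑ˡ j i) ⟨
    heightFrom G (map (level (suc j)) (children (suc j) (i ↑ˡ S j))) ∎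
    where
    G : Multigraph
    G = canonical (suc j)
    open ≡-Reasoning
  ... | right y = begin
    level (suc j) (n j ↑ʳ y)                                 ≡⟨ cong proj₁ (decode-↑ʳ j y) ⟩
    level j y                                                ≡⟨ level-eq j y ⟩
    heightFrom (canonical j) (map (level j) (children j y))  ≡⟨ heightFrom-cong (canonical j) G _ ⟩
    heightFrom G (map (level j) (children j y))              ≡⟨ cong (heightFrom G) (map-level-lift j _) ⟨
    heightFrom G (map (level (suc j)) (map (n j ↑ʳ_) (children j y)))
      ≡⟨ cong (heightFrom G ∘ map (level (suc j))) (children-↑ʳ j y) ⟨
    heightFrom G (map (level (suc j)) (children (suc j) (n j ↑ʳ y))) ∎
    where
    G : Multigraph
    G = canonical (suc j)
    open ≡-Reasoning

  level-↭ : ∀ j {x y} → children j x ↭ children j y → level j x ≡ level j y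
  level-↭ j {x} {y} p =
    trans (level-eq j x) (trans (heightFrom-↭ (canonical j) (map⁺ (level j) p)) (sym (level-eq j y)))

  topChildren-injective : ∀ j {i i′} → topChildren j i ↭ topChildren j i′ → i ≡ i′
  topChildren-injective zero    {zero} {zero} _ = refl
  topChildren-injective (suc j)                = elem-injective (admissible d (n j) (S j))

  unlift : ∀ j {ys zs : List (Fin (S j))} → map (n j ↑ʳ_) ys ↭ map (n j ↑ʳ_) zs → ys ↭ zs
  unlift j = ↭-map-injective (↑ʳ-injective (n j) _ _)

  distinct : ∀ j → DistinctChildren (canonical j)
  distinct (suc j) x y p with splitView (n j) x | splitView (n j) y
  ... | left i  | left i′  = cong (_↑ˡ S j)
    (topChildren-injective j (unlift j (subst₂ _↭_ (children-↑ˡ j i) (children-↑ˡ j i′) p)))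
  ... | right z | right z′ = cong (n j ↑ʳ_)
    (distinct j z z′ (unlift j (subst₂ _↭_ (children-↑ʳ j z) (children-↑ʳ j z′) p)))
  ... | left i  | right z  = ⊥-elim (top≢lift j i z (level-↭ (suc j) p))
  ... | right z | left i   = ⊥-elim (top≢lift j i z (sym (level-↭ (suc j) p)))

  bounded : ∀ j → OutdegAtMost d (canonical j)
  bounded (suc j) x with splitView (n j) x
  ... | left i  rewrite children-↑ˡ j i | length-map (n j ↑ʳ_) (topChildren j i) =
    topChildren-bounded j i
    where
    topChildren-bounded : ∀ j i → length (topChildren j i) ≤ d
    topChildren-bounded zero    _ = z≤n
    topChildren-bounded (suc j) i = proj₁ (elem-sat (admissible d (n j) (S j)) i)
  ... | right y rewrite children-↑ʳ j y | length-map (n j ↑ʳ_) (children j y) = bounded j y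

  lower-bound : ∀ h → Σ Multigraph λ G → IsFDAG G × OutdegAtMost d G × AtLeastOfHeight G h (n h)
  lower-bound h =
    canonical (suc h) ,
    (acyclic , connected (distinct (suc h)) , distinct (suc h)) ,
    bounded (suc h) ,
    (_↑ˡ S h) , (λ {i} {i′} → ↑ˡ-injective (S h) i i′) ,
    (λ i → subst (HasHeight _ _) (cong proj₁ (decode-↑ˡ h i)) (hasHeight-level (i ↑ˡ S h)))
    where open Levelled (canonical (suc h)) (level (suc h)) (level-eq (suc h))

  module _ (G : Multigraph) (distinct-G : DistinctChildren G) (bounded-G : OutdegAtMost d G) where
    open Multigraph G using (V; child)

    Graded : Set
    Graded = Σ (Fin V) λ v → Σ ℕ (HasHeight G v)

    vertex : Graded → Fin V
    vertex = proj₁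

    height : Graded → ℕ
    height = proj₁ ∘ proj₂

    graded : ∀ {cs hs} → Pointwise (HasHeight G) cs hs → List Graded
    graded []       = []
    graded (p ∷ ps) = (_ , _ , p) ∷ graded ps

    map-vertex-graded : ∀ {cs hs} (pw : Pointwise (HasHeight G) cs hs) → map vertex (graded pw) ≡ cs
    map-vertex-graded []       = refl
    map-vertex-graded (p ∷ ps) = cong (_ ∷_) (map-vertex-graded ps)

    graded-heights : ∀ {P : ℕ → Set} {cs hs} (pw : Pointwise (HasHeight G) cs hs) →
                     All P hs → All (P ∘ height) (graded pw)
    graded-heights []       []       = []
    graded-heights (p ∷ ps) (b ∷ bs) = b ∷ graded-heights ps bs

    -- A vertex of height m + 1 is sent to the index of the admissible multiset formed by
    -- its children, each placed in canonical (suc m) according to its own code.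
    mutual
      encode : ∀ {v h} → HasHeight G v h → Fin (n h)
      encode (hasHeight []       _ ) = zero
      encode (hasHeight {v} (h ∷ hs) pw) =
        index (admissible d (n m) (S m))
              (length≤d , top-∈-levels⁻ m (subst (m ∈_) (sym levels) (maxList-∈ G h hs)))
        where
        m : ℕ
        m = maxList G (h ∷ hs)

        zs : List (Fin (S (suc m)))
        zs = codes pw (maxList-upper G (h ∷ hs))

        levels : map (level (suc m)) zs ≡ h ∷ hs
        levels = levels-codes pw (maxList-upper G (h ∷ hs))

        length≤d : length zs ≤ d
        length≤d = subst (_≤ d)
          (trans (Pointwise-length pw) (trans (cong length (sym levels)) (length-map (level (suc m)) zs)))
          (bounded-G v)

      codes : ∀ {m cs hs} → Pointwise (HasHeight G) cs hs → All (_≤ m) hs → List (Fin (S (suc m)))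
      codes []       []       = []
      codes (p ∷ ps) (b ∷ bs) = embed (≤⇒≤′ b) (encode p) ∷ codes ps bs

      levels-codes : ∀ {m cs hs} (pw : Pointwise (HasHeight G) cs hs) (bs : All (_≤ m) hs) →
                     map (level (suc m)) (codes pw bs) ≡ hs
      levels-codes []       []       = refl
      levels-codes (p ∷ ps) (b ∷ bs) =
        cong₂ _∷_ (cong proj₁ (decode-embed (≤⇒≤′ b) (encode p))) (levels-codes ps bs)

    code : Graded → Code
    code (_ , h , p) = h , encode p

    decode-codes : ∀ {m cs hs} (pw : Pointwise (HasHeight G) cs hs) (bs : All (_≤ m) hs) →
                   map (decode (suc m)) (codes pw bs) ≡ map code (graded pw)
    decode-codes []       []       = refl
    decode-codes (p ∷ ps) (b ∷ bs) = cong₂ _∷_ (decode-embed (≤⇒≤′ b) (encode p)) (decode-codes ps bs)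

    same-index⇒↭ : ∀ {m m′} {zs : List (Fin (S (suc m)))} {zs′ : List (Fin (S (suc m′)))}
                   (a : Admissible d (n m) zs) (a′ : Admissible d (n m′) zs′) →
                   _≡_ {A = Code} (suc m , index (admissible d (n m) (S m)) a)
                                  (suc m′ , index (admissible d (n m′) (S m′)) a′) →
                   map (decode (suc m)) zs ↭ map (decode (suc m′)) zs′
    same-index⇒↭ {m} {zs′ = zs′} a a′ e with Σ-≡,≡←≡ e
    ... | refl , i≡i′ = map⁺ (decode (suc m)) (↭-trans (↭-elem-index E a)
                          (subst (λ i → elem E i ↭ zs′) (sym i≡i′) (↭-sym (↭-elem-index E a′))))
      where
      E : Enumeration (Admissible d (n m) {S m})
      E = admissible d (n m) (S m)

    -- Equal codes give the same admissible multiset of child codes; by induction on the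
    -- height the children are then permuted, and DistinctChildren identifies the vertices.
    code-injective : ∀ N (g g′ : Graded) → height g ≤ N → code g ≡ code g′ → vertex g ≡ vertex g′
    code-injective N (v , _ , hasHeight [] pw) (v′ , _ , hasHeight [] pw′) _ _ =
      distinct-G v v′ (↭-reflexive (trans (Pointwise-[]ʳ pw) (sym (Pointwise-[]ʳ pw′))))
    code-injective N    (_ , _ , hasHeight []      _) (_ , _ , hasHeight (_ ∷ _) _) _  ()
    code-injective N    (_ , _ , hasHeight (_ ∷ _) _) (_ , _ , hasHeight []      _) _  ()
    code-injective zero (_ , _ , hasHeight (_ ∷ _) _) (_ , _ , hasHeight (_ ∷ _) _) () _
    code-injective (suc N) (v , _ , hasHeight (h ∷ hs) pw) (v′ , _ , hasHeight (h′ ∷ hs′) pw′) (s≤s m≤N) e =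
      distinct-G v v′ (subst₂ _↭_ (map-vertex-graded pw) (map-vertex-graded pw′)
        (↭-map-reflect code vertex
          (All.map (λ {g} g≤m g′ → code-injective N g g′ (≤-trans g≤m m≤N)) (graded-heights pw bounds))
          (subst₂ _↭_ (decode-codes pw bounds) (decode-codes pw′ bounds′) (same-index⇒↭ _ _ e))))
      where
      bounds : All (_≤ maxList G (h ∷ hs)) (h ∷ hs)
      bounds = maxList-upper G (h ∷ hs)
      bounds′ : All (_≤ maxList G (h′ ∷ hs′)) (h′ ∷ hs′)
      bounds′ = maxList-upper G (h′ ∷ hs′)

    upper-bound : ∀ h k → AtLeastOfHeight G h k → k ≤ n h
    upper-bound h k (f , f-injective , f-height) = injective⇒≤ {f = encode ∘ f-height} λ {i} {j} e →
      f-injective (code-injective h (_ , _ , f-height i) (_ , _ , f-height j) ≤-refl (cong (h ,_) e))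

  S≡sum : ∀ j → S j ≡ sum (map n (upTo j))
  S≡sum zero    = refl
  S≡sum (suc j) = begin
    n j + S j                  ≡⟨ cong (n j +_) (S≡sum j) ⟩
    sum (map n (j ∷ upTo j))   ≡⟨ sum-↭ (map⁺ n (∷↭∷ʳ j (upTo j))) ⟩
    sum (map n (upTo j ∷ʳ j))  ≡⟨ cong (sum ∘ map n) (upTo-∷ʳ j) ⟩
    sum (map n (upTo (suc j))) ∎
    where open ≡-Reasoning

  n1≡d : n 1 ≡ d
  n1≡d = begin
    n 1                                                                      ≡⟨ size-admissible d 1 0 ⟩
    sum (map (λ k → ((k + 1 ∸ 1) C k) * ((d ∸ k + 0) C (d ∸ k))) (ranks d)) ≡⟨ sum-map-ones (ranks d) one ⟩
    length (ranks d)                                                         ≡⟨ length-map suc (upTo d) ⟩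
    length (upTo d)                                                          ≡⟨ length-upTo d ⟩
    d                                                                        ∎
    where
    open ≡-Reasoning
    one : ∀ k → ((k + 1 ∸ 1) C k) * ((d ∸ k + 0) C (d ∸ k)) ≡ 1
    one k rewrite m+n∸n≡m k 1 | +-identityʳ (d ∸ k) | nCn≡1 k | nCn≡1 (d ∸ k) = refl
    sum-map-ones : ∀ {f : ℕ → ℕ} xs → (∀ k → f k ≡ 1) → sum (map f xs) ≡ length xs
    sum-map-ones []       _   = refl
    sum-map-ones (x ∷ xs) f≡1 = cong₂ _+_ (f≡1 x) (sum-map-ones xs f≡1)

lemma4p4 : (d : ℕ) → 1 ≤ d →
    Σ (ℕ → ℕ) λ n →
      (∀ h → IsMaxCount d h (n h))
      × n 0 ≡ 1
      × n 1 ≡ d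
      × (∀ h → n (2 + h) ≡
           sum (map (λ k → ((k + n (1 + h) ∸ 1) C k)
                           * (((d ∸ k) + sum (map n (upTo (suc h)))) C (d ∸ k)))
                    (map suc (upTo d))))
lemma4p4 d _ =
  n ,
  (λ h → lower-bound h , λ G (_ , _ , distinct-G) bounded-G → upper-bound G distinct-G bounded-G h) ,
  refl ,
  n1≡d ,
  λ h → trans (size-admissible d (n (1 + h)) (S (1 + h)))
              (cong (λ b → sum (map (λ k → ((k + n (1 + h) ∸ 1) C k) * ((d ∸ k + b) C (d ∸ k))) (ranks d)))
                    (S≡sum (suc h)))
  where open Canonical d
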